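{- Let $p\colon Y\to X$ be a covering map and $y_0$ a vertex of $Y$. Then $p$ induces an isomorphism $A_n(Y,y_0)\to A_n(X,p(y_0))$ for all $n\ge2$, and a monomorphism $A_1(Y,y_0)\to A_1(X,p(y_0))$.
   Context: Graphs are simple undirected loopless graphs; graph maps send adjacent vertices to equal or adjacent vertices. $I_n$ has vertices $0,\dots,n$, edges $i\sim i+1$; $I_\infty$ has vertices $\mathbb{Z}$, edges $i\sim i+1$; $I_1\square I_1$ is the $4$-cycle on $\{0,1\}^2$ (adjacent iff differing in one coordinate). The internal hom $[A,B]$ has graph maps $A\to B$ as vertices, $f\sim g$ iff $f\neq g$ and pointwise equal-or-adjacent. For a pointed graph $(Z,z_0)$, $\Omega_\infty(Z,z_0)$ is the full subgraph of $[I_\infty,Z]$ on maps $\gamma$ with integers $N_-,N_+$ such that $\gamma(i)=z_0$ for $i\le N_-$ and $i\ge N_+$, pointed at the constant map; $\Omega_\infty^n$ is its $n$-fold iterate, and $A_n(X,x_0)=\pi_0\Omega^n_\infty(X,x_0)$ (path-components), a group for $n\ge1$ under the operation induced by concatenation of loops of length $\infty$ in the outermost loop coordinate ($(\gamma\ast\sigma)(i)=\gamma(i)$ for $i\le M_+$, $\sigma(i-M_++N_-)$ for $i\ge M_+$, with $M_+$ least such that $\gamma$ is constant at the base point from $M_+$ on and $N_-$ largest such that $\sigma$ is constant at the base point up to $N_-$); a pointed graph map induces group homomorphisms on $A_n$ by postcomposition. A graph map $p\colon Y\to X$ is a covering map if (i) for every vertex $y$, $p$ restricts to a bijection from $y$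 together with its neighbours onto $p(y)$ together with its neighbours, and (ii) for all graph maps $u\colon I_3\to Y$, $v\colon I_1\square I_1\to X$ with $p(u(0))=v(1,0)$, $p(u(1))=v(0,0)$, $p(u(2))=v(0,1)$, $p(u(3))=v(1,1)$, one has $u(0)=u(3)$ or $u(0)\sim u(3)$. -}

module Defs where

open import Data.Nat using (ℕ; zero; suc)
open import Data.Fin as Fin using (Fin; toℕ)
open import Data.Bool using (Bool)
open import Data.Integer as ℤ using (ℤ; 0ℤ)
open import Data.Product using (Σ; ∃; ∃-syntax; _×_; _,_; proj₁; proj₂)
open import Data.Sum using (_⊎_; inj₁; inj₂)
open import Relation.Binary.PropositionalEquality using (_≡_; _≢_; refl; cong)
open import Relation.Binary.Construct.Closure.ReflexiveTransitive using (Star)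
open import Relation.Nullary using (¬_)

record Graph : Set₁ where
  field
    V     : Set
    _~_   : V → V → Set
    ~-sym : ∀ {a b} → a ~ b → b ~ a
    ~-irr : ∀ {a} → ¬ (a ~ a)
open Graph public

_⊢_≃~_ : (G : Graph) → V G → V G → Set
G ⊢ a ≃~ b = a ≡ b ⊎ _~_ G a b

record GraphMap (A B : Graph) : Set where
  field
    fun  : V A → V B
    pres : ∀ {a a'} → _~_ A a a' → B ⊢ fun a ≃~ fun a'
open GraphMap public

I : ℕ → Graph
I n = record
  { V = Fin (suc n)
  ; _~_ = λ i j → (toℕ j ≡ suc (toℕ i)) ⊎ (toℕ i ≡ suc (toℕ j))
  ; ~-sym = λ { (inj₁ e) → inj₂ e ; (inj₂ e) → inj₁ e }
  ; ~-irr = irr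
  }
  where
  nsuc : ∀ {m : ℕ} → m ≢ suc m
  nsuc ()
  irr : ∀ {i : Fin (suc n)} → ¬ ((toℕ i ≡ suc (toℕ i)) ⊎ (toℕ i ≡ suc (toℕ i)))
  irr (inj₁ e) = nsuc e
  irr (inj₂ e) = nsuc e

-- I_1 □ I_1 : the 4-cycle on {0,1}² (Bool × Bool), adjacent iff differing
-- in exactly one coordinate
Square : Graph
Square = record
  { V = Bool × Bool
  ; _~_ = λ { (a , b) (c , d) → ((a ≡ c) × (b ≢ d)) ⊎ ((a ≢ c) × (b ≡ d)) }
  ; ~-sym = λ { (inj₁ (e , n)) → inj₁ (sym' e , λ x → n (sym' x))
              ; (inj₂ (n , e)) → inj₂ ((λ x → n (sym' x)) , sym' e) }
  ; ~-irr = λ { (inj₁ (_ , n)) → n refl ; (inj₂ (n , _)) → n refl }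
  }
  where
  sym' : ∀ {A : Set} {x y : A} → x ≡ y → y ≡ x
  sym' refl = refl

-- the vertex (a,b) ∈ {0,1}²  (false = 0, true = 1)
open import Data.Bool using (true; false)

f0 f1 f2 f3 : Fin 4
f0 = Fin.zero
f1 = Fin.suc Fin.zero
f2 = Fin.suc (Fin.suc Fin.zero)
f3 = Fin.suc (Fin.suc (Fin.suc Fin.zero))

-- closed neighbourhood N[y] = {y} ∪ neighbours of y
record IsCovering {Y X : Graph} (p : GraphMap Y X) : Set where
  field
    -- (i) p restricts to a bijection N[y] → N[p y]
    nbhd-inj : ∀ (y y₁ y₂ : V Y) → Y ⊢ y ≃~ y₁ → Y ⊢ y ≃~ y₂ →
               fun p y₁ ≡ fun p y₂ → y₁ ≡ y₂
    nbhd-surj : ∀ (y : V Y) (x : V X) → X ⊢ fun p y ≃~ x →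
                ∃[ y' ] (Y ⊢ y ≃~ y') × (fun p y' ≡ x)
    square : ∀ (u : GraphMap (I 3) Y) (v : GraphMap Square X) →
             fun p (fun u (f0)) ≡ fun v (true , false) →
             fun p (fun u (f1)) ≡ fun v (false , false) →
             fun p (fun u (f2)) ≡ fun v (false , true) →
             fun p (fun u (f3)) ≡ fun v (true , true) →
             Y ⊢ fun u (f0) ≃~ fun u (f3)

-- "Setoid graphs": a vertex type with vertex equality _≈_ and the
-- equal-or-adjacent relation _≍_.  Needed because the vertices of
-- internal homs [I_∞, Z] are maps, whose equality is pointwise.

record PGraph : Set₁ where
  field
    C      : Set
    _≈_    : C → C → Set
    _≍_    : C → C → Set
    ≈-refl : ∀ {a} → a ≈ a
    ≍-refl : ∀ {a} → a ≍ a
    pt     : C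
open PGraph public

base : (X : Graph) → V X → PGraph
base X x₀ = record
  { C = V X ; _≈_ = _≡_ ; _≍_ = λ a b → X ⊢ a ≃~ b
  ; ≈-refl = refl ; ≍-refl = inj₁ refl ; pt = x₀ }

-- Ω_∞(Z, z₀): graph maps γ : I_∞ → Z that are at the base point
-- for i ≤ N₋ and for i ≥ N₊; vertex equality and equal-or-adjacency
-- are pointwise (as in the internal hom [I_∞, Z]); base point = constant map.
Ω∞ : PGraph → PGraph
Ω∞ Z = record
  { C = Σ (ℤ → C Z) λ γ →
          (∀ i → _≍_ Z (γ i) (γ (ℤ.suc i))) ×
          (∃[ N₋ ] ∃[ N₊ ] (∀ i → i ℤ.≤ N₋ → _≈_ Z (γ i) (pt Z))
                         × (∀ i → N₊ ℤ.≤ i → _≈_ Z (γ i) (pt Z)))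
  ; _≈_ = λ γ σ → ∀ i → _≈_ Z (proj₁ γ i) (proj₁ σ i)
  ; _≍_ = λ γ σ → ∀ i → _≍_ Z (proj₁ γ i) (proj₁ σ i)
  ; ≈-refl = λ i → ≈-refl Z
  ; ≍-refl = λ i → ≍-refl Z
  ; pt = (λ _ → pt Z) , (λ _ → ≍-refl Z) , 0ℤ , 0ℤ , (λ _ _ → ≈-refl Z) , (λ _ _ → ≈-refl Z)
  }

Ω∞^ : ℕ → PGraph → PGraph
Ω∞^ zero    Z = Z
Ω∞^ (suc n) Z = Ω∞ (Ω∞^ n Z)

record PMap (A B : PGraph) : Set where
  field
    app    : C A → C B
    ≍-pres : ∀ {a a'} → _≍_ A a a' → _≍_ B (app a) (app a')
    ≈-pres : ∀ {a a'} → _≈_ A a a' → _≈_ B (app a) (app a')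
    pt-pres : ∀ {a} → _≈_ A a (pt A) → _≈_ B (app a) (pt B)
open PMap public

baseMap : {Y X : Graph} (p : GraphMap Y X) (y₀ : V Y) →
          PMap (base Y y₀) (base X (fun p y₀))
baseMap p y₀ = record
  { app = fun p
  ; ≍-pres = λ { (inj₁ refl) → inj₁ refl ; (inj₂ a) → pres p a }
  ; ≈-pres = cong (fun p)
  ; pt-pres = cong (fun p) }

Ω∞map : {A B : PGraph} → PMap A B → PMap (Ω∞ A) (Ω∞ B)
Ω∞map f = record
  { app = λ { (γ , st , N₋ , N₊ , l , r) →
              (λ i → app f (γ i)) , (λ i → ≍-pres f (st i)) , N₋ , N₊ ,
              (λ i h → pt-pres f (l i h)) , (λ i h → pt-pres f (r i h)) }
  ; ≍-pres = λ h i → ≍-pres f (h i)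
  ; ≈-pres = λ h i → ≈-pres f (h i)
  ; pt-pres = λ h i → pt-pres f (h i) }

Ω∞^map : (n : ℕ) {A B : PGraph} → PMap A B → PMap (Ω∞^ n A) (Ω∞^ n B)
Ω∞^map zero    f = f
Ω∞^map (suc n) f = Ω∞map (Ω∞^map n f)

-- A_n(X,x₀) = π₀ Ω^n_∞(X,x₀) is the quotient of C (Ω∞^ n (base X x₀)) by this.
SameComponent : (Z : PGraph) → C Z → C Z → Set
SameComponent Z = Star (_≍_ Z)

π₀-Injective : {A B : PGraph} → PMap A B → Set
π₀-Injective {A} {B} f = ∀ a a' → SameComponent B (app f a) (app f a') → SameComponent A a a'

π₀-Surjective : {A B : PGraph} → PMap A B → Set
π₀-Surjective {A} {B} f = ∀ b → ∃[ a ] SameComponent B (app f a) b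

A-map : (n : ℕ) {Y X : Graph} (p : GraphMap Y X) (y₀ : V Y) →
        PMap (Ω∞^ n (base Y y₀)) (Ω∞^ n (base X (fun p y₀)))
A-map n p y₀ = Ω∞^map n (baseMap p y₀)

-- Everything rests on unique lifting of paths that sit at the base point far to the left.
-- Such a path in X lifts edge by edge, through the local bijections of p, to a path in Y
-- sitting at y₀ far to the left; and the square condition shows, rung by rung from the
-- left, that lifts of pointwise equal-or-adjacent paths are again pointwise equal-or-adjacent
-- (hence lifts are unique).  Since p is injective on closed neighbourhoods, a lift adjacent
-- to a lift that returns to y₀ also returns to y₀, so a chain of loops joining p∘σ to p∘σ'
-- lifts to a chain of loops joining σ to σ': p is injective on A₁.  A 2-loop in X starts at
-- the constant loop, so each of its loops lifts to a loop, and lifting loop by loop inverts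
-- postcomposition with p on Ω²; applying Ω_∞ to such an inverse gives one on every Ωⁿ, n ≥ 2.

module Submission where

open import Defs
open import Data.Nat using (ℕ; _≤_; zero; suc; z≤n; s≤s)
open import Data.Product using (_×_; Σ; ∃-syntax; _,_; proj₁; proj₂)
import Data.Nat.Properties as ℕ
open import Data.Bool using (Bool; true; false)
open import Data.Empty using (⊥-elim)
open import Data.Fin using (Fin; toℕ; inject₁) renaming (zero to fzero; suc to fsuc)
open import Data.Vec using (_∷_; []; lookup)
open import Data.Integer as ℤ using (ℤ; +_; -[1+_]; +[1+_]; 0ℤ; 1ℤ; _-_)
import Data.Integer.Properties as ℤ
open import Algebra.Properties.CommutativeSemigroup ℤ.+-commutativeSemigroup using (x∙yz≈y∙xz)
open import Data.Integer.Tactic.RingSolver using (solve-∀)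
open import Function using (_∘_)
open import Data.Sum using (inj₁; inj₂)
open import Relation.Binary.PropositionalEquality using (_≡_; _≢_; refl; sym; trans; cong; subst)
open import Relation.Binary.Construct.Closure.ReflexiveTransitive using (ε; _◅_; _◅◅_; gmap)

≃~-sym : {G : Graph} {a b : V G} → G ⊢ a ≃~ b → G ⊢ b ≃~ a
≃~-sym (inj₁ a≡b) = inj₁ (sym a≡b)
≃~-sym {G} (inj₂ a~b) = inj₂ (~-sym G a~b)

I-adjacent⇒consecutive : ∀ {n} (i j : Fin (suc n)) → toℕ j ≡ suc (toℕ i) →
                         ∃[ k ] i ≡ inject₁ k × j ≡ fsuc k
I-adjacent⇒consecutive {suc n} fzero (fsuc fzero) _ = fzero , refl , refl
I-adjacent⇒consecutive {suc n} (fsuc i) (fsuc j) e with I-adjacent⇒consecutive i j (ℕ.suc-injective e)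
... | k , refl , refl = fsuc k , refl , refl
I-adjacent⇒consecutive {zero} fzero (fsuc ()) _
I-adjacent⇒consecutive {suc n} fzero (fsuc (fsuc j)) ()
I-adjacent⇒consecutive (fsuc i) fzero ()
I-adjacent⇒consecutive {zero} (fsuc ()) _ _

walk-map : {G : Graph} {n : ℕ} (u : Fin (suc n) → V G) →
           (∀ k → G ⊢ u (inject₁ k) ≃~ u (fsuc k)) → GraphMap (I n) G
walk-map {G} {n} u step = record { fun = u ; pres = preserves }
  where
  forward : ∀ {i j} → toℕ j ≡ suc (toℕ i) → G ⊢ u i ≃~ u j
  forward {i} {j} e with I-adjacent⇒consecutive i j e
  ... | k , refl , refl = step k
  preserves : ∀ {i j} → _~_ (I n) i j → G ⊢ u i ≃~ u j
  preserves (inj₁ e) = forward e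
  preserves (inj₂ e) = ≃~-sym {G} (forward e)

≃~-across : {G : Graph} (f : Bool → V G) → G ⊢ f false ≃~ f true →
            ∀ {a b} → a ≢ b → G ⊢ f a ≃~ f b
≃~-across {G} f e {false} {true}  _   = e
≃~-across {G} f e {true}  {false} _   = ≃~-sym {G} e
≃~-across {G} f e {false} {false} a≢b = ⊥-elim (a≢b refl)
≃~-across {G} f e {true}  {true}  a≢b = ⊥-elim (a≢b refl)

square-map : {G : Graph} (v : Bool × Bool → V G) →
             (∀ b → G ⊢ v (false , b) ≃~ v (true , b)) →
             (∀ a → G ⊢ v (a , false) ≃~ v (a , true)) → GraphMap Square G
square-map {G} v first second = record { fun = v ; pres = preserves }
  where
  preserves : ∀ {s t} → _~_ Square s t → G ⊢ v s ≃~ v t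
  preserves {a , b} {.a , d} (inj₁ (refl , b≢d)) = ≃~-across {G} (λ b → v (a , b)) (second a) b≢d
  preserves {a , b} {c , .b} (inj₂ (a≢c , refl)) = ≃~-across {G} (λ a → v (a , b)) (first b) a≢c

i+[j-i]≡j : ∀ i j → i ℤ.+ (j - i) ≡ j
i+[j-i]≡j = solve-∀

ℤ-induction-from : {P : ℤ → Set} (m : ℤ) → (∀ i → i ℤ.≤ m → P i) →
                   (∀ i → P i → P (ℤ.suc i)) → ∀ i → P i
ℤ-induction-from {P} m below step i with ℤ.≤-total i m
... | inj₁ i≤m = below i i≤m
... | inj₂ m≤i = subst P m+∣i-m∣≡i (above ℤ.∣ i - m ∣)
  where
  above : ∀ n → P (m ℤ.+ + n)
  above zero    = subst P (sym (ℤ.+-identityʳ m)) (below m ℤ.≤-refl)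
  above (suc n) = subst P (x∙yz≈y∙xz 1ℤ m (+ n)) (step _ (above n))
  m+∣i-m∣≡i : m ℤ.+ + ℤ.∣ i - m ∣ ≡ i
  m+∣i-m∣≡i = trans (cong (λ j → m ℤ.+ j) (ℤ.0≤i⇒+∣i∣≡i (ℤ.i≤j⇒0≤j-i m≤i)))
                    (i+[j-i]≡j m i)

record IsCoherent (Z : PGraph) : Set where
  field
    ≈-sym : ∀ {a b} → _≈_ Z a b → _≈_ Z b a
    ≈⇒≍   : ∀ {a b} → _≈_ Z a b → _≍_ Z a b

base-isCoherent : (G : Graph) (x : V G) → IsCoherent (base G x)
base-isCoherent G x = record { ≈-sym = sym ; ≈⇒≍ = inj₁ }

Ω∞^-isCoherent : ∀ n {Z} → IsCoherent Z → IsCoherent (Ω∞^ n Z)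
Ω∞^-isCoherent zero    coh = coh
Ω∞^-isCoherent (suc n) coh = record
  { ≈-sym = λ h i → ≈-sym (h i) ; ≈⇒≍ = λ h i → ≈⇒≍ (h i) }
  where open IsCoherent (Ω∞^-isCoherent n coh)

record PIso {A B : PGraph} (f : PMap A B) : Set where
  field
    inverse       : PMap B A
    right-inverse : ∀ b → _≈_ B (app f (app inverse b)) b
    left-inverse  : ∀ a → _≈_ A (app inverse (app f a)) a

Ω∞map-PIso : {A B : PGraph} {f : PMap A B} → PIso f → PIso (Ω∞map f)
Ω∞map-PIso iso = record
  { inverse       = Ω∞map inverse
  ; right-inverse = λ γ i → right-inverse (proj₁ γ i)
  ; left-inverse  = λ γ i → left-inverse (proj₁ γ i)
  }
  where open PIso iso

PIso⇒π₀-Injective : {A B : PGraph} {f : PMap A B} → IsCoherent A → PIso f → π₀-Injective f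
PIso⇒π₀-Injective coh iso a a' fa~fa' =
  ≈⇒≍ (≈-sym (left-inverse a)) ◅
  gmap (app inverse) (≍-pres inverse) fa~fa' ◅◅
  ≈⇒≍ (left-inverse a') ◅ ε
  where open IsCoherent coh; open PIso iso

PIso⇒π₀-Surjective : {A B : PGraph} {f : PMap A B} → IsCoherent B → PIso f → π₀-Surjective f
PIso⇒π₀-Surjective coh iso b = app inverse b , IsCoherent.≈⇒≍ coh (right-inverse b) ◅ ε
  where open PIso iso

module Covering {Y X : Graph} {p : GraphMap Y X} (cov : IsCovering p) (y₀ : V Y) where
  open IsCovering cov

  x₀ : V X
  x₀ = fun p y₀

  ΩY ΩX : PGraph
  ΩY = Ω∞ (base Y y₀)
  ΩX = Ω∞ (base X x₀)

  same-image⇒≡ : {a b : V Y} → Y ⊢ a ≃~ b → fun p a ≡ fun p b → a ≡ b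
  same-image⇒≡ {a} = nbhd-inj a a _ (inj₁ refl)

  record WalkLift (w : ℕ → V X) (y : V Y) : Set where
    field
      vertex       : ℕ → V Y
      vertex-zero  : vertex 0 ≡ y
      vertex-steps : ∀ k → Y ⊢ vertex k ≃~ vertex (suc k)
      vertex-over  : ∀ k → fun p (vertex k) ≡ w k

  lift-walk : (w : ℕ → V X) → (∀ k → X ⊢ w k ≃~ w (suc k)) →
              (y : V Y) → fun p y ≡ w 0 → WalkLift w y
  lift-walk w step y py≡w₀ = record
    { vertex       = proj₁ ∘ lifted
    ; vertex-zero  = refl
    ; vertex-steps = λ k → proj₁ (proj₂ (next k))
    ; vertex-over  = proj₂ ∘ lifted
    }
    where
    lifted : (k : ℕ) → Σ (V Y) λ y' → fun p y' ≡ w k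
    next : (k : ℕ) → ∃[ y' ] Y ⊢ proj₁ (lifted k) ≃~ y' × fun p y' ≡ w (suc k)
    lifted zero    = y , py≡w₀
    lifted (suc k) = proj₁ (next k) , proj₂ (proj₂ (next k))
    next k = nbhd-surj _ _ (subst (λ x → X ⊢ x ≃~ w (suc k)) (sym (proj₂ (lifted k))) (step k))

  record Lift (γ : C ΩX) : Set where
    field
      path   : ℤ → V Y
      steps  : ∀ i → Y ⊢ path i ≃~ path (ℤ.suc i)
      over   : ∀ i → fun p (path i) ≡ proj₁ γ i
      start  : ℤ
      before : ∀ i → i ℤ.≤ start → path i ≡ y₀
  open Lift

  lift : (γ : C ΩX) → Lift γ
  lift (γ , γ-steps , N , _ , γ-before , _) = record
    { path   = λ i → from-N (i - N)
    ; steps  = λ i → subst (λ j → Y ⊢ from-N (i - N) ≃~ from-N j) (sym (ℤ.+-assoc 1ℤ i (ℤ.- N)))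
                           (from-N-steps (i - N))
    ; over   = λ i → trans (from-N-over (i - N)) (cong γ (i+[j-i]≡j N i))
    ; start  = N
    ; before = λ i i≤N → from-N-before (i - N) (ℤ.i≤j⇒i-j≤0 i≤N)
    }
    where
    w : ℕ → V X
    w k = γ (N ℤ.+ + k)
    w-steps : ∀ k → X ⊢ w k ≃~ w (suc k)
    w-steps k = subst (λ j → X ⊢ w k ≃~ γ j) (x∙yz≈y∙xz 1ℤ N (+ k)) (γ-steps _)
    w-zero : x₀ ≡ w 0
    w-zero = sym (γ-before _ (ℤ.≤-reflexive (ℤ.+-identityʳ N)))
    open WalkLift (lift-walk w w-steps y₀ w-zero)

    from-N : ℤ → V Y
    from-N (+ k)    = vertex k
    from-N -[1+ _ ] = y₀

    from-N-steps : ∀ j → Y ⊢ from-N j ≃~ from-N (ℤ.suc j)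
    from-N-steps (+ k)         = vertex-steps k
    from-N-steps -[1+ zero ]   = inj₁ (sym vertex-zero)
    from-N-steps -[1+ suc _ ]  = inj₁ refl

    from-N-over : ∀ j → fun p (from-N j) ≡ γ (N ℤ.+ j)
    from-N-over (+ k)    = vertex-over k
    from-N-over -[1+ n ] = sym (γ-before _ (ℤ.i≤j⇒i-k≤j +[1+ n ] ℤ.≤-refl))

    from-N-before : ∀ j → j ℤ.≤ 0ℤ → from-N j ≡ y₀
    from-N-before (+ zero)   _             = vertex-zero
    from-N-before +[1+ _ ]   (ℤ.+≤+ ())
    from-N-before -[1+ _ ]   _             = refl

  lifts-≍ : ∀ {γ γ'} → _≍_ ΩX γ γ' → (L : Lift γ) (L' : Lift γ') →
            ∀ i → Y ⊢ path L i ≃~ path L' i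
  lifts-≍ {γ , γ-steps , _} {γ' , γ'-steps , _} γ≍γ' L L' =
    ℤ-induction-from (start L ℤ.⊓ start L') both-at-base rung
    where
    both-at-base : ∀ i → i ℤ.≤ start L ℤ.⊓ start L' → Y ⊢ path L i ≃~ path L' i
    both-at-base i i≤ = inj₁ (trans (before L i (ℤ.≤-trans i≤ (ℤ.i⊓j≤i _ _)))
                                    (sym (before L' i (ℤ.≤-trans i≤ (ℤ.i⊓j≤j _ _)))))
    rung : ∀ i → Y ⊢ path L i ≃~ path L' i → Y ⊢ path L (ℤ.suc i) ≃~ path L' (ℤ.suc i)
    rung i rungᵢ = square
      (walk-map (lookup (path L (ℤ.suc i) ∷ path L i ∷ path L' i ∷ path L' (ℤ.suc i) ∷ []))
                λ { fzero → ≃~-sym {Y} (steps L i)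
                  ; (fsuc fzero) → rungᵢ
                  ; (fsuc (fsuc fzero)) → steps L' i })
      (square-map (λ { (false , false) → γ i ; (true , false) → γ (ℤ.suc i)
                     ; (false , true) → γ' i ; (true , true) → γ' (ℤ.suc i) })
                  (λ { false → γ-steps i ; true → γ'-steps i })
                  (λ { false → γ≍γ' i ; true → γ≍γ' (ℤ.suc i) }))
      (over L (ℤ.suc i)) (over L i) (over L' i) (over L' (ℤ.suc i))

  lifts-≡ : ∀ {γ γ'} → _≈_ ΩX γ γ' → (L : Lift γ) (L' : Lift γ') →
            ∀ i → path L i ≡ path L' i
  lifts-≡ γ≈γ' L L' i = same-image⇒≡ (lifts-≍ (inj₁ ∘ γ≈γ') L L' i)
                                     (trans (over L i) (trans (γ≈γ' i) (sym (over L' i))))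

  constant-lift : Lift (pt ΩX)
  constant-lift = record
    { path = λ _ → y₀ ; steps = λ _ → inj₁ refl ; over = λ _ → refl
    ; start = 0ℤ ; before = λ _ _ → refl }

  lift-of-constant : ∀ {γ} → _≈_ ΩX γ (pt ΩX) → (L : Lift γ) → ∀ i → path L i ≡ y₀
  lift-of-constant γ≈pt L = lifts-≡ γ≈pt L constant-lift

  ReturnsToBase : ∀ {γ} → Lift γ → Set
  ReturnsToBase L = ∃[ K ] ∀ i → K ℤ.≤ i → path L i ≡ y₀

  returns-≍ : ∀ {γ γ'} → _≍_ ΩX γ γ' → (L : Lift γ) (L' : Lift γ') →
              ReturnsToBase L → ReturnsToBase L'
  returns-≍ {γ' = _ , _ , _ , N₊ , _ , γ'-after} γ≍γ' L L' (K , after-K) = K ℤ.⊔ N₊ , λ i K⊔N₊≤i →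
    sym (same-image⇒≡
          (subst (λ y → Y ⊢ y ≃~ path L' i) (after-K i (ℤ.≤-trans (ℤ.i≤i⊔j K N₊) K⊔N₊≤i))
                 (lifts-≍ γ≍γ' L L' i))
          (sym (trans (over L' i) (γ'-after i (ℤ.≤-trans (ℤ.i≤j⊔i K N₊) K⊔N₊≤i)))))

  to-loop : ∀ {γ} (L : Lift γ) → ReturnsToBase L → C ΩY
  to-loop L (K , after-K) = path L , steps L , start L , K , before L , after-K

  own-lift : (σ : C ΩY) → Lift (app (A-map 1 p y₀) σ)
  own-lift (σ , σ-steps , N₋ , _ , σ-before , _) = record
    { path = σ ; steps = σ-steps ; over = λ _ → refl ; start = N₋ ; before = σ-before }

  own-returns : (σ : C ΩY) → ReturnsToBase (own-lift σ)
  own-returns (_ , _ , _ , N₊ , _ , σ-after) = N₊ , σ-after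

  lift-component : ∀ {δ δ'} → SameComponent ΩX δ δ' → (L : Lift δ) (r : ReturnsToBase L) →
                   Σ (Lift δ') λ L' → Σ (ReturnsToBase L') λ r' →
                     SameComponent ΩY (to-loop L r) (to-loop L' r')
  lift-component ε L r = L , r , ε
  lift-component (_◅_ {j = δ₁} δ≍δ₁ rest) L r
    with lift-component rest (lift δ₁) (returns-≍ δ≍δ₁ L (lift δ₁) r)
  ... | L' , r' , lifted = L' , r' , lifts-≍ δ≍δ₁ L (lift δ₁) ◅ lifted

  A₁-injective : π₀-Injective (A-map 1 p y₀)
  A₁-injective σ σ' pσ~pσ' with lift-component pσ~pσ' (own-lift σ) (own-returns σ)
  ... | L' , _ , lifted = lifted ◅◅ (inj₁ ∘ lifts-≡ (λ _ → refl) L' (own-lift σ')) ◅ ε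

  lift-2-loop : C (Ω∞ ΩX) → C (Ω∞ ΩY)
  lift-2-loop (Γ , Γ-steps , N₋ , N₊ , Γ-before , Γ-after) =
    (λ i → to-loop (lift (Γ i)) (returns i)) ,
    (λ i → lifts-≍ (Γ-steps i) (lift (Γ i)) (lift (Γ (ℤ.suc i)))) ,
    N₋ , N₊ , (λ i i≤N₋ → lift-of-constant (Γ-before i i≤N₋) (lift (Γ i))) ,
              (λ i N₊≤i → lift-of-constant (Γ-after i N₊≤i) (lift (Γ i)))
    where
    returns : ∀ i → ReturnsToBase (lift (Γ i))
    returns = ℤ-induction-from N₋
      (λ i i≤N₋ → 0ℤ , λ j _ → lift-of-constant (Γ-before i i≤N₋) (lift (Γ i)) j)
      (λ i → returns-≍ (Γ-steps i) (lift (Γ i)) (lift (Γ (ℤ.suc i))))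

  A₂-PIso : PIso (A-map 2 p y₀)
  A₂-PIso = record
    { inverse = record
      { app     = lift-2-loop
      ; ≍-pres  = λ {Γ} {Γ'} Γ≍Γ' i → lifts-≍ (Γ≍Γ' i) (lift (proj₁ Γ i)) (lift (proj₁ Γ' i))
      ; ≈-pres  = λ {Γ} {Γ'} Γ≈Γ' i → lifts-≡ (Γ≈Γ' i) (lift (proj₁ Γ i)) (lift (proj₁ Γ' i))
      ; pt-pres = λ {Γ} Γ≈pt i → lift-of-constant (Γ≈pt i) (lift (proj₁ Γ i))
      }
    ; right-inverse = λ Γ i → over (lift (proj₁ Γ i))
    ; left-inverse  = λ S i →
        lifts-≡ (λ _ → refl) (lift (app (A-map 1 p y₀) (proj₁ S i))) (own-lift (proj₁ S i))
    }

A-map-PIso : {Y X : Graph} {p : GraphMap Y X} → IsCovering p → (y₀ : V Y) →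
             ∀ m → PIso (A-map (suc (suc m)) p y₀)
A-map-PIso cov y₀ zero    = Covering.A₂-PIso cov y₀
A-map-PIso cov y₀ (suc m) = Ω∞map-PIso (A-map-PIso cov y₀ m)

proposition4p14 : (Y X : Graph) (p : GraphMap Y X) → IsCovering p → (y₀ : V Y) →
    ((n : ℕ) → 2 ≤ n → π₀-Injective (A-map n p y₀) × π₀-Surjective (A-map n p y₀))
    × π₀-Injective (A-map 1 p y₀)
proposition4p14 Y X p cov y₀ = higher , Covering.A₁-injective cov y₀
  where
  higher : (n : ℕ) → 2 ≤ n → π₀-Injective (A-map n p y₀) × π₀-Surjective (A-map n p y₀)
  higher (suc (suc m)) (s≤s (s≤s z≤n)) =
    PIso⇒π₀-Injective (Ω∞^-isCoherent (suc (suc m)) (base-isCoherent Y y₀)) iso ,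
    PIso⇒π₀-Surjective (Ω∞^-isCoherent (suc (suc m)) (base-isCoherent X (fun p y₀))) iso
    where
    iso : PIso (A-map (suc (suc m)) p y₀)
    iso = A-map-PIso cov y₀ m
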